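{- Every completely meager P$^+$-filter on $\omega$ is hereditarily meager.
   Context: A filter on $\omega$ is a family of subsets of $\omega$ closed under finite intersections and supersets and containing all cofinite sets; it is proper if it contains only infinite sets. $\mathcal F^+=\{X\subseteq\omega:\omega\setminus X\notin\mathcal F\}$; $A\subseteq^*B$ means $A\setminus B$ is finite. Subsets of $\omega$ are identified with characteristic functions in $2^\omega$ (product topology), and "meager" refers to this topology. $\mathcal F$ is completely meager if the filter generated by $\mathcal F\cup\{X\}$ is meager whenever $X\in\mathcal F^+$. $\mathcal F$ is a P$^+$-filter if for every sequence $X_0\supseteq^*X_1\supseteq^*\cdots$ from $\mathcal F^+$ there is $X\in\mathcal F^+$ with $X\subseteq^*X_n$ for all $n$. For $f\in{}^\omega\omega$, $f(\mathcal F)=\{Y\subseteq\omega:f^{ -1}(Y)\in\mathcal F\}$; $\mathcal F$ is hereditarily meager if for every $f\in{}^\omega\omega$, $f(\mathcal F)$ is meager or improper. -}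

module Defs where

open import Data.Nat using (ℕ; zero; suc; _≤_)
open import Data.Bool using (Bool; true; false; _∧_; not)
open import Data.List using (List; []; _∷_; _++_)
open import Data.List.Relation.Unary.All using (All)
open import Data.Product using (Σ; _×_; ∃; ∃-syntax; _,_)
open import Data.Sum using (_⊎_)
open import Data.Unit using (⊤)
open import Relation.Nullary using (¬_)
open import Relation.Binary.PropositionalEquality using (_≡_)

-- Subsets of ω are identified with characteristic functions (points of 2^ω).
Subset : Set
Subset = ℕ → Bool

Family : Set₁
Family = Subset → Set

_∈ˢ_ : ℕ → Subset → Set
n ∈ˢ X = X n ≡ true

_⊆_ : Subset → Subset → Set
A ⊆ B = ∀ n → n ∈ˢ A → n ∈ˢ B

_⊆*_ : Subset → Subset → Set
A ⊆* B = ∃[ k ] (∀ n → k ≤ n → n ∈ˢ A → n ∈ˢ B)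

_∩_ : Subset → Subset → Subset
(A ∩ B) n = A n ∧ B n

complement : Subset → Subset
complement A n = not (A n)

full : Subset
full _ = true

Cofinite : Subset → Set
Cofinite A = ∃[ k ] (∀ n → k ≤ n → n ∈ˢ A)

Infinite : Subset → Set
Infinite A = ∀ k → ∃[ n ] (k ≤ n × n ∈ˢ A)

record IsFilter (F : Family) : Set where
  field
    closed-∩      : ∀ A B → F A → F B → F (A ∩ B)
    closed-⊇      : ∀ A B → A ⊆ B → F A → F B
    has-cofinite  : ∀ A → Cofinite A → F A

Proper : Family → Set
Proper F = ∀ A → F A → Infinite A

Plus : Family → Family
Plus F X = ¬ F (complement X)

⋂ : List Subset → Subset
⋂ [] = full
⋂ (A ∷ As) = A ∩ ⋂ As

Generated : Family → Subset → Family
Generated F X Y =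
  Σ (List Subset) λ As →
    All (λ A → F A ⊎ (∀ n → A n ≡ X n) ⊎ Cofinite A) As × (⋂ As ⊆ Y)

image : (ℕ → ℕ) → Family → Family
image f F Y = F (λ n → Y (f n))

-- basic open sets of 2^ω: s ≺ x means the finite string s is an initial segment of x
_≺_ : List Bool → Subset → Set
[] ≺ x = ⊤
(b ∷ s) ≺ x = (b ≡ x 0) × (s ≺ (λ n → x (suc n)))

_⊑_ : List Bool → List Bool → Set
s ⊑ t = ∃[ u ] (t ≡ s ++ u)

-- Meager in 2^ω: contained in a countable union of closed nowhere dense sets.
-- g n describes a dense open set U_n = ⋃_s [g n s] (g n s extends s);
-- M is meager iff every x ∈ M lies outside some U_n.
Meager : Family → Set
Meager M =
  Σ (ℕ → List Bool → List Bool) λ g →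
    (∀ n s → s ⊑ g n s) ×
    (∀ x → M x → ∃[ n ] (∀ s → ¬ (g n s ≺ x)))

CompletelyMeager : Family → Set
CompletelyMeager F = ∀ X → Plus F X → Meager (Generated F X)

IsPPlusFilter : Family → Set
IsPPlusFilter F =
  (Xs : ℕ → Subset) → (∀ n → Plus F (Xs n)) → (∀ n → Xs (suc n) ⊆* Xs n) →
  Σ Subset λ X → Plus F X × (∀ n → X ⊆* Xs n)

HereditarilyMeager : Family → Set
HereditarilyMeager F = (f : ℕ → ℕ) → Meager (image f F) ⊎ ¬ Proper (image f F)

-- Properness of f(F) makes every set {m : L ≤ f m} F-positive, so the P⁺-property gives
-- X ∈ F⁺ on which f tends to infinity, and complete meagerness makes the filter generated
-- by F ∪ {X} meager. As in Talagrand's characterisation of meager filters, a meager upward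
-- closed family admits an interval partition of ω such that each of its members meets almost
-- every interval: a member missing infinitely many intervals could be enlarged on those
-- intervals to a member lying in every dense open set witnessing meagerness. For Z ∈ f(F) the set
-- f⁻¹Z ∩ X is such a member, so Z contains some f i with i in the k-th interval for every
-- large k; as f → ∞ on X, the value f i lies beyond any given string s and below a bound
-- depending only on s and k, hence padding s with enough zeros yields, for each N, a dense
-- family of basic open sets that all sets of f(F) avoid.
module Submission where

open import Defs
open import Level using (0ℓ)
open import Axiom.ExcludedMiddle using (ExcludedMiddle)
open import Axiom.DoubleNegationElimination using (DoubleNegationElimination; em⇒dne)
open import Data.Nat
open import Data.Nat.Properties
open import Data.Bool using (Bool; true; false; _∧_; not; if_then_else_)
open import Data.Bool.Properties
  using (∧-identityʳ; ∧-conicalˡ; ∧-conicalʳ; not-involutive; ¬-not; T-≡; if-cong)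
open import Data.List using (List; []; _∷_; _++_; length; replicate)
open import Data.List.Properties using (++-assoc; ++-identityʳ; length-++; length-replicate)
open import Data.List.Relation.Unary.All using ([]; _∷_)
open import Data.Product using (Σ; _×_; _,_; proj₁; proj₂; ∃-syntax)
open import Data.Sum using (inj₁; inj₂)
open import Data.Unit using (tt)
open import Function using (_∘_; Equivalence)
open import Relation.Nullary using (¬_; yes; no; contradiction)
open import Relation.Binary.PropositionalEquality

≤ᵇ≡true⇒≤ : ∀ {m n} → (m ≤ᵇ n) ≡ true → m ≤ n
≤ᵇ≡true⇒≤ {m} {n} e = ≤ᵇ⇒≤ m n (Equivalence.from T-≡ e)

≤⇒≤ᵇ≡true : ∀ {m n} → m ≤ n → (m ≤ᵇ n) ≡ true
≤⇒≤ᵇ≡true m≤n = Equivalence.to T-≡ (≤⇒≤ᵇ m≤n)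

>⇒≤ᵇ≡false : ∀ {m n} → n < m → (m ≤ᵇ n) ≡ false
>⇒≤ᵇ≡false n<m = ¬-not (λ e → <⇒≱ n<m (≤ᵇ≡true⇒≤ e))

<ᵇ≡true⇒< : ∀ {m n} → (m <ᵇ n) ≡ true → m < n
<ᵇ≡true⇒< {m} {n} e = <ᵇ⇒< m n (Equivalence.from T-≡ e)

<⇒<ᵇ≡true : ∀ {m n} → m < n → (m <ᵇ n) ≡ true
<⇒<ᵇ≡true m<n = Equivalence.to T-≡ (<⇒<ᵇ m<n)

InfinitelyOften : (ℕ → Bool) → Set
InfinitelyOften b = ∀ j → ∃[ k ] (j ≤ k × b k ≡ true)

¬infinitelyOften⇒eventuallyFalse : DoubleNegationElimination 0ℓ → (b : ℕ → Bool) →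
  ¬ InfinitelyOften b → ∃[ N ] (∀ k → N ≤ k → b k ≡ false)
¬infinitelyOften⇒eventuallyFalse dne b finitelyOften = dne λ never →
  finitelyOften λ j → dne λ none →
    never (j , λ k j≤k → ¬-not (λ bk → none (k , j≤k , bk)))

falseExtension : List Bool → Subset
falseExtension []      _       = false
falseExtension (b ∷ _) zero    = b
falseExtension (_ ∷ s) (suc i) = falseExtension s i

prefix : Subset → ℕ → List Bool
prefix x zero    = []
prefix x (suc m) = x 0 ∷ prefix (x ∘ suc) m

length-prefix : ∀ x m → length (prefix x m) ≡ m
length-prefix x zero    = refl
length-prefix x (suc m) = cong suc (length-prefix (x ∘ suc) m)

falseExtension-prefix : ∀ x {m i} → i < m → falseExtension (prefix x m) i ≡ x i
falseExtension-prefix x {suc m} {zero}  _           = refl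
falseExtension-prefix x {suc m} {suc i} (s≤s i<m) = falseExtension-prefix (x ∘ suc) i<m

falseExtension-++ : ∀ s u {i} → i < length s → falseExtension (s ++ u) i ≡ falseExtension s i
falseExtension-++ (_ ∷ s) u {zero}  _           = refl
falseExtension-++ (_ ∷ s) u {suc i} (s≤s i<∣s∣) = falseExtension-++ s u i<∣s∣

falseExtension-replicate : ∀ c i → falseExtension (replicate c false) i ≡ false
falseExtension-replicate zero    i       = refl
falseExtension-replicate (suc c) zero    = refl
falseExtension-replicate (suc c) (suc i) = falseExtension-replicate c i

falseExtension-padded : ∀ s c {i} → length s ≤ i → falseExtension (s ++ replicate c false) i ≡ false
falseExtension-padded []      c {i}     _           = falseExtension-replicate c i
falseExtension-padded (_ ∷ s) c {suc i} (s≤s ∣s∣≤i) = falseExtension-padded s c ∣s∣≤i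

agree⇒≺ : ∀ s {x} → (∀ i → i < length s → falseExtension s i ≡ x i) → s ≺ x
agree⇒≺ []      _     = tt
agree⇒≺ (b ∷ s) agree = agree 0 z<s , agree⇒≺ s (λ i i<∣s∣ → agree (suc i) (s≤s i<∣s∣))

≺⇒agree : ∀ s {x} i → s ≺ x → i < length s → falseExtension s i ≡ x i
≺⇒agree (_ ∷ s) zero    (b≡x0 , _) _           = b≡x0
≺⇒agree (_ ∷ s) (suc i) (_ , s≺x)  (s≤s i<∣s∣) = ≺⇒agree s i s≺x i<∣s∣

⊑-refl : ∀ s → s ⊑ s
⊑-refl s = [] , sym (++-identityʳ s)

⊑-trans : ∀ {s t u} → s ⊑ t → t ⊑ u → s ⊑ u
⊑-trans {s} (a , refl) (b , refl) = a ++ b , ++-assoc s a b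

⊑-≺-trans : ∀ {s t x} → s ⊑ t → t ≺ x → s ≺ x
⊑-≺-trans {[]}    _          _            = tt
⊑-≺-trans {_ ∷ s} (u , refl) (b≡x0 , t≺x) = b≡x0 , ⊑-≺-trans {s} (u , refl) t≺x

maxOverStrings : (List Bool → ℕ) → ℕ → ℕ
maxOverStrings φ zero    = φ []
maxOverStrings φ (suc m) = maxOverStrings (φ ∘ (true ∷_)) m ⊔ maxOverStrings (φ ∘ (false ∷_)) m

≤-maxOverStrings : ∀ φ p → φ p ≤ maxOverStrings φ (length p)
≤-maxOverStrings φ []          = ≤-refl
≤-maxOverStrings φ (true ∷ p)  = ≤-trans (≤-maxOverStrings (φ ∘ (true ∷_)) p) (m≤m⊔n _ _)
≤-maxOverStrings φ (false ∷ p) = ≤-trans (≤-maxOverStrings (φ ∘ (false ∷_)) p) (m≤n⊔m _ _)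

strictBound : (ℕ → ℕ) → ℕ → ℕ
strictBound f zero    = 0
strictBound f (suc b) = strictBound f b ⊔ suc (f b)

<-strictBound : ∀ f {m b} → m < b → f m < strictBound f b
<-strictBound f {m} {suc b} (s≤s m≤b) with m≤n⇒m<n∨m≡n m≤b
... | inj₁ m<b  = ≤-trans (<-strictBound f m<b) (m≤m⊔n _ _)
... | inj₂ refl = m≤n⊔m (strictBound f b) (suc (f m))

misses : Subset → ℕ → ℕ → Bool
misses A a zero    = true
misses A a (suc l) = not (A a) ∧ misses A (suc a) l

misses⇒∉ : ∀ A a l → misses A a l ≡ true → ∀ {i} → a ≤ i → i < a + l → A i ≡ false
misses⇒∉ A a zero    _ a≤i i<a+0 = contradiction (subst (_ <_) (+-identityʳ a) i<a+0) (≤⇒≯ a≤i)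
misses⇒∉ A a (suc l) e {i} a≤i i<a+l with m≤n⇒m<n∨m≡n a≤i
... | inj₂ refl = trans (sym (not-involutive (A a))) (cong not (∧-conicalˡ _ _ e))
... | inj₁ a<i  = misses⇒∉ A (suc a) l (∧-conicalʳ _ _ e) a<i (subst (i <_) (+-suc a l) i<a+l)

¬misses⇒meets : ∀ A a l → misses A a l ≡ false → ∃[ i ] (a ≤ i × i < a + l × i ∈ˢ A)
¬misses⇒meets A a (suc l) e with A a in a∈A
... | true  = a , ≤-refl , m<m+n a z<s , a∈A
... | false with ¬misses⇒meets A (suc a) l e
...   | i , a<i , i<a+l , i∈A = i , <⇒≤ a<i , subst (i <_) (sym (+-suc a l)) i<a+l , i∈A

StrictlyIncreasing : (ℕ → ℕ) → Set
StrictlyIncreasing cut = ∀ k → cut k < cut (suc k)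

EventuallyMeets : (ℕ → ℕ) → Subset → Set
EventuallyMeets cut A = ∃[ N ] (∀ k → N ≤ k → ∃[ i ] (cut k ≤ i × i < cut (suc k) × i ∈ˢ A))

module _ {cut : ℕ → ℕ} (increasing : StrictlyIncreasing cut) where

  strictlyIncreasing⇒monotone : ∀ {k k'} → k ≤ k' → cut k ≤ cut k'
  strictlyIncreasing⇒monotone {k} {zero}   z≤n   = ≤-refl
  strictlyIncreasing⇒monotone {k} {suc k'} k≤k' with m≤n⇒m<n∨m≡n k≤k'
  ... | inj₂ refl        = ≤-refl
  ... | inj₁ (s≤s k≤k'') = ≤-trans (strictlyIncreasing⇒monotone k≤k'') (<⇒≤ (increasing k'))

  strictlyIncreasing⇒inflationary : ∀ k → k ≤ cut k
  strictlyIncreasing⇒inflationary zero    = z≤n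
  strictlyIncreasing⇒inflationary (suc k) =
    ≤-trans (s≤s (strictlyIncreasing⇒inflationary k)) (increasing k)

-- Talagrand's interval partition of a meager upward closed family

UpwardClosed : Family → Set
UpwardClosed G = ∀ {A B} → A ⊆ B → G A → G B

module IntervalPartition (g : ℕ → List Bool → List Bool) (g-extends : ∀ k s → s ⊑ g k s) where

  h : ℕ → List Bool → List Bool
  h zero    = g 0
  h (suc k) = g (suc k) ∘ h k

  ⊑-h : ∀ k p → p ⊑ h k p
  ⊑-h zero    p = g-extends 0 p
  ⊑-h (suc k) p = ⊑-trans (⊑-h k p) (g-extends (suc k) (h k p))

  g⊑h : ∀ {j k} p → j ≤ k → ∃[ q ] (g j q ⊑ h k p)
  g⊑h {zero} {zero}  p _     = p , ⊑-refl _
  g⊑h {j}    {suc k} p j≤1+k with m≤n⇒m<n∨m≡n j≤1+k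
  ... | inj₂ refl      = h k p , ⊑-refl _
  ... | inj₁ (s≤s j≤k) with g⊑h p j≤k
  ...   | q , gq⊑hkp = q , ⊑-trans gq⊑hkp (g-extends (suc k) (h k p))

  -- The k-th interval [cut k, cut (suc k)) is long enough to contain h k p for all p ∈ 2^(cut k).
  cut   : ℕ → ℕ
  width : ℕ → ℕ
  cut zero    = 0
  cut (suc k) = cut k + width k
  width k = suc (maxOverStrings (length ∘ h k) (cut k))

  cut-strictlyIncreasing : StrictlyIncreasing cut
  cut-strictlyIncreasing k = m<m+n (cut k) z<s

  length-h≤cut : ∀ k p → length p ≡ cut k → length (h k p) ≤ cut (suc k)
  length-h≤cut k p ∣p∣≡cut = begin
    length (h k p)                              ≤⟨ ≤-maxOverStrings (length ∘ h k) p ⟩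
    maxOverStrings (length ∘ h k) (length p)   ≡⟨ cong (maxOverStrings (length ∘ h k)) ∣p∣≡cut ⟩
    maxOverStrings (length ∘ h k) (cut k)      ≤⟨ n≤1+n _ ⟩
    width k                                     ≤⟨ m≤n+m (width k) (cut k) ⟩
    cut (suc k)                                 ∎
    where open ≤-Reasoning

  -- Stage k + 1 overwrites the k-th interval, if A misses it, by the end of h k applied to
  -- the first cut k values of stage k; filled is the limit of the stages.
  module Filling (A : Subset) where

    missesInterval : ℕ → Bool
    missesInterval k = misses A (cut k) (width k)

    inInterval : ℕ → ℕ → Bool
    inInterval k i = (cut k ≤ᵇ i) ∧ (i <ᵇ cut (suc k))

    stage  : ℕ → Subset
    filler : ℕ → List Bool
    stage zero    = A
    stage (suc k) i = if inInterval k i ∧ missesInterval k then falseExtension (filler k) i else stage k i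
    filler k = h k (prefix (stage k) (cut k))

    filled : Subset
    filled i = stage (suc i) i

    stage-suc-below : ∀ k {i} → i < cut k → stage (suc k) i ≡ stage k i
    stage-suc-below k {i} i<cut =
      if-cong (cong (λ b → (b ∧ (i <ᵇ cut (suc k))) ∧ missesInterval k) (>⇒≤ᵇ≡false i<cut))

    stage-stable : ∀ {k k' i} → k ≤ k' → i < cut k → stage k' i ≡ stage k i
    stage-stable {k} {zero}   z≤n   _     = refl
    stage-stable {k} {suc k'} k≤k' i<cut with m≤n⇒m<n∨m≡n k≤k'
    ... | inj₂ refl        = refl
    ... | inj₁ (s≤s k≤k'') =
      trans (stage-suc-below k' (≤-trans i<cut (strictlyIncreasing⇒monotone cut-strictlyIncreasing k≤k'')))
            (stage-stable k≤k'' i<cut)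

    filled≡stage : ∀ k {i} → i < cut (suc k) → filled i ≡ stage (suc k) i
    filled≡stage k {i} i<cut with ≤-total i k
    ... | inj₁ i≤k = sym (stage-stable (s≤s i≤k)
                           (≤-trans (s≤s (strictlyIncreasing⇒inflationary cut-strictlyIncreasing i))
                                    (cut-strictlyIncreasing i)))
    ... | inj₂ k≤i = stage-stable (s≤s k≤i) i<cut

    A⊆stage : ∀ k → A ⊆ stage k
    A⊆stage zero    i i∈A = i∈A
    A⊆stage (suc k) i i∈A with inInterval k i ∧ missesInterval k in overwritten
    ... | false = A⊆stage k i i∈A
    ... | true  = contradiction (trans (sym i∉A) i∈A) λ ()
      where
      inside = ∧-conicalˡ (inInterval k i) _ overwritten
      i∉A = misses⇒∉ A (cut k) (width k) (∧-conicalʳ (inInterval k i) _ overwritten)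
              (≤ᵇ≡true⇒≤ (∧-conicalˡ _ _ inside)) (<ᵇ≡true⇒< (∧-conicalʳ _ _ inside))

    A⊆filled : A ⊆ filled
    A⊆filled i = A⊆stage (suc i) i

    stage-filler : ∀ k → missesInterval k ≡ true →
      ∀ {i} → i < cut (suc k) → stage (suc k) i ≡ falseExtension (filler k) i
    stage-filler k missed {i} i<cut' with cut k ≤? i
    ... | yes cut≤i = if-cong (trans (cong₂ (λ a b → (a ∧ b) ∧ missesInterval k)
                                            (≤⇒≤ᵇ≡true cut≤i) (<⇒<ᵇ≡true i<cut')) missed)
    ... | no cut≰i = begin
      stage (suc k) i                          ≡⟨ stage-suc-below k i<cut ⟩
      stage k i                                ≡⟨ falseExtension-prefix (stage k) i<cut ⟨
      falseExtension p i                       ≡⟨ falseExtension-++ p u i<∣p∣ ⟨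
      falseExtension (p ++ u) i                ≡⟨ cong (λ t → falseExtension t i) p++u≡filler ⟩
      falseExtension (filler k) i              ∎
      where
      open ≡-Reasoning
      i<cut = ≰⇒> cut≰i
      p = prefix (stage k) (cut k)
      u = proj₁ (⊑-h k p)
      p++u≡filler = sym (proj₂ (⊑-h k p))
      i<∣p∣ = subst (i <_) (sym (length-prefix (stage k) (cut k))) i<cut

    filler≺filled : ∀ k → missesInterval k ≡ true → filler k ≺ filled
    filler≺filled k missed = agree⇒≺ (filler k) λ i i<∣filler∣ →
      let i<cut = ≤-trans i<∣filler∣ (length-h≤cut k _ (length-prefix (stage k) (cut k)))
      in trans (sym (stage-filler k missed i<cut)) (sym (filled≡stage k i<cut))

    filled-meetsAll : InfinitelyOften missesInterval → ∀ j → ∃[ s ] (g j s ≺ filled)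
    filled-meetsAll missedOften j with missedOften j
    ... | k , j≤k , missed with g⊑h (prefix (stage k) (cut k)) j≤k
    ...   | q , gjq⊑filler = q , ⊑-≺-trans gjq⊑filler (filler≺filled k missed)

meager-upwardClosed⇒eventuallyMeets : ExcludedMiddle 0ℓ → (G : Family) → UpwardClosed G →
  Meager G → ∃[ cut ] (StrictlyIncreasing cut × (∀ A → G A → EventuallyMeets cut A))
meager-upwardClosed⇒eventuallyMeets em G upward (g , g-extends , avoidsSome) =
  cut , cut-strictlyIncreasing , eventuallyMeets
  where
  open IntervalPartition g g-extends

  eventuallyMeets : ∀ A → G A → EventuallyMeets cut A
  eventuallyMeets A GA with ¬infinitelyOften⇒eventuallyFalse (em⇒dne em) missesInterval missedRarely
    where
    open Filling A
    missedRarely : ¬ InfinitelyOften missesInterval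
    missedRarely missedOften with avoidsSome filled (upward A⊆filled GA)
    ... | j , avoids with filled-meetsAll missedOften j
    ...   | s , gjs≺filled = avoids s gjs≺filled
  ... | N , met = N , λ k N≤k → ¬misses⇒meets A (cut k) (width k) (met k N≤k)

-- Meagerness of the image family

atLeast : ℕ → Subset
atLeast L n = L ≤ᵇ n

TendsToInfinityOn : (ℕ → ℕ) → Subset → Set
TendsToInfinityOn f X = ∀ L → X ⊆* (atLeast L ∘ f)

meager-if-preimages-eventuallyMeet : (f : ℕ → ℕ) (X : Subset) → TendsToInfinityOn f X →
  (M : Family) (cut : ℕ → ℕ) → StrictlyIncreasing cut →
  (∀ Z → M Z → EventuallyMeets cut ((Z ∘ f) ∩ X)) → Meager M
meager-if-preimages-eventuallyMeet f X f→∞ M cut increasing meets = pad , (λ _ _ → _ , refl) , avoided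
  where
  threshold : ℕ → ℕ
  threshold L = proj₁ (f→∞ L)

  padLength : ℕ → ℕ → ℕ
  padLength N L = strictBound f (cut (suc (N + threshold L)))

  pad : ℕ → List Bool → List Bool
  pad N s = s ++ replicate (padLength N (length s)) false

  avoided : ∀ Z → M Z → ∃[ N ] (∀ s → ¬ (pad N s ≺ Z))
  avoided Z MZ with meets Z MZ
  ... | N , met = N , avoids
    where
    avoids : ∀ s → ¬ (pad N s ≺ Z)
    avoids s pad≺Z with met (N + threshold (length s)) (m≤m+n _ _)
    ... | i , cut≤i , i<cut' , i∈ = contradiction (trans (sym padded) (trans agree fi∈Z)) λ ()
      where
      L = length s
      fi∈Z = ∧-conicalˡ _ _ i∈
      threshold≤i = ≤-trans (m≤n+m (threshold L) N)
                      (≤-trans (strictlyIncreasing⇒inflationary increasing _) cut≤i)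
      L≤fi = ≤ᵇ≡true⇒≤ (proj₂ (f→∞ L) i threshold≤i (∧-conicalʳ _ _ i∈))
      fi<∣pad∣ = subst (f i <_) (sym (trans (length-++ s) (cong (L +_) (length-replicate _))))
                   (≤-trans (<-strictBound f i<cut') (m≤n+m _ L))
      padded = falseExtension-padded s (padLength N L) L≤fi
      agree = ≺⇒agree (pad N s) (f i) pad≺Z fi<∣pad∣

tendsToInfinityOnPositive : (F : Family) → IsPPlusFilter F → (f : ℕ → ℕ) → Proper (image f F) →
  Σ Subset λ X → Plus F X × TendsToInfinityOn f X
tendsToInfinityOnPositive F pPlus f proper = pPlus (λ L → atLeast L ∘ f) positive decreasing
  where
  positive : ∀ L → Plus F (atLeast L ∘ f)
  positive L F∌ with proper (complement (atLeast L)) F∌ L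
  ... | n , L≤n , n∉ = contradiction (trans (sym (cong not (≤⇒≤ᵇ≡true L≤n))) n∉) λ ()

  decreasing : ∀ L → (atLeast (suc L) ∘ f) ⊆* (atLeast L ∘ f)
  decreasing L = 0 , λ m _ e → ≤⇒≤ᵇ≡true (≤-trans (n≤1+n L) (≤ᵇ≡true⇒≤ e))

Generated-upwardClosed : ∀ F X → UpwardClosed (Generated F X)
Generated-upwardClosed F X A⊆B (As , generators , ⋂As⊆A) = As , generators , λ n e → A⊆B n (⋂As⊆A n e)

∩-Generated : ∀ F X {A} → F A → Generated F X (A ∩ X)
∩-Generated F X {A} FA = A ∷ X ∷ [] , inj₁ FA ∷ inj₂ (inj₁ λ _ → refl) ∷ [] ,
  λ n e → subst (λ b → A n ∧ b ≡ true) (∧-identityʳ (X n)) e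

mainTheorem8 : ExcludedMiddle 0ℓ → (F : Family) → IsFilter F →
    CompletelyMeager F → IsPPlusFilter F → HereditarilyMeager F
mainTheorem8 em F _ completelyMeager pPlus f with em {Proper (image f F)}
... | no improper = inj₂ improper
... | yes proper  =
  inj₁ (meager-if-preimages-eventuallyMeet f X f→∞ (image f F) cut increasing
          λ Z FZ → meets ((Z ∘ f) ∩ X) (∩-Generated F X FZ))
  where
  X⁺ = tendsToInfinityOnPositive F pPlus f proper
  X = proj₁ X⁺
  f→∞ = proj₂ (proj₂ X⁺)
  partition = meager-upwardClosed⇒eventuallyMeets em (Generated F X) (Generated-upwardClosed F X)
                (completelyMeager X (proj₁ (proj₂ X⁺)))
  cut = proj₁ partition
  increasing = proj₁ (proj₂ partition)
  meets = proj₂ (proj₂ partition)
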